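{- Let $\Delta$ be a $(d-1)$-dimensional Buchsbaum simplicial complex, i.e. a pure simplicial complex such that for every vertex $v$ of $\Delta$ the link of $v$ is Cohen-Macaulay. Then $(-1)^i\chi_i(\Delta)\ge 0$ for $0\le i\le\lfloor (d-1)/2\rfloor$.
   Context: $f_j(\Delta)$ is the number of $j$-dimensional faces of $\Delta$, and $\chi_i(\Delta)=\sum_{j=0}^i(-1)^jf_j(\Delta)$ is the Euler characteristic of the $i$-dimensional skeleton of $\Delta$. A pure complex is one whose maximal faces all have the same dimension. The link of a vertex $v$ is $\{F\in\Delta: v\notin F,\ F\cup\{v\}\in\Delta\}$. Cohen-Macaulay is in the usual sense (e.g. over a field: the Stanley–Reisner ring is Cohen–Macaulay). -}

module Defs where

open import Level using (Level; _⊔_) renaming (suc to lsuc)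
open import Data.Nat as ℕ using (ℕ; zero; suc; _≤_; _<_)
open import Data.Bool using (_≟_; Bool; true; false; _∧_; not; if_then_else_)
open import Data.Vec using (Vec; []; _∷_; lookup)
open import Data.List using (List; []; _∷_; _++_; map; filter; length)
open import Data.Fin using (Fin; toℕ) renaming (zero to fzero; suc to fsuc)
open import Data.Fin.Subset using (Subset; _∪_; ⁅_⁆; ∣_∣; _⊆_)
open import Data.Integer as ℤ using (ℤ; +_)
open import Data.Product using (Σ; _×_; _,_; ∃)
open import Relation.Nullary using (¬_)
open import Relation.Binary.PropositionalEquality using (_≡_)
open import Algebra.Bundles using (CommutativeRing)
import Relation.Binary.PropositionalEquality as P

record Field (c ℓ : Level) : Set (lsuc (c ⊔ ℓ)) where
  field
    commRing : CommutativeRing c ℓ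
  open CommutativeRing commRing public
  field
    0≉1     : ¬ (0# ≈ 1#)
    inverse : ∀ x → ¬ (x ≈ 0#) → ∃ λ y → (x * y) ≈ 1#

record SimplicialComplex (n : ℕ) : Set where
  field
    face     : Subset n → Bool
    empty∈   : face (Data.Vec.replicate n false) ≡ true
    down     : ∀ {σ τ} → face σ ≡ true → τ ⊆ σ → face τ ≡ true

IsFace : ∀ {n} → (Subset n → Bool) → Subset n → Set
IsFace Γ σ = Γ σ ≡ true

IsVertex : ∀ {n} → SimplicialComplex n → Fin n → Set
IsVertex Δ v = IsFace (SimplicialComplex.face Δ) ⁅ v ⁆

disjointᵇ : ∀ {n} → Subset n → Subset n → Bool
disjointᵇ []        []        = true
disjointᵇ (x ∷ xs)  (y ∷ ys)  = not (x ∧ y) ∧ disjointᵇ xs ys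

linkF : ∀ {n} → (Subset n → Bool) → Subset n → (Subset n → Bool)
linkF Γ F G = disjointᵇ G F ∧ Γ (G ∪ F)

vertexLink : ∀ {n} → SimplicialComplex n → Fin n → (Subset n → Bool)
vertexLink Δ v = linkF (SimplicialComplex.face Δ) ⁅ v ⁆

-- Maximal faces and purity of dimension d - 1 (all facets have d vertices).
IsMaximal : ∀ {n} → (Subset n → Bool) → Subset n → Set
IsMaximal Γ σ = IsFace Γ σ × (∀ τ → IsFace Γ τ → σ ⊆ τ → τ ≡ σ)

IsPureOfDim-1+ : ∀ {n} → SimplicialComplex n → ℕ → Set
IsPureOfDim-1+ Δ d = ∀ σ → IsMaximal (SimplicialComplex.face Δ) σ → ∣ σ ∣ ≡ d

module Homology {c ℓ} (K : Field c ℓ) where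
  open Field K

  sumFin : ∀ {n} → (Fin n → Carrier) → Carrier
  sumFin {zero}  f = 0#
  sumFin {suc n} f = f fzero + sumFin (λ i → f (fsuc i))

  below : ∀ {n} → Subset n → Fin n → ℕ
  below {n} σ v = length (filter (λ u → (toℕ u) ℕ.<? (toℕ v)) (members σ))
    where
      members : ∀ {m} → Subset m → List (Fin m)
      members []          = []
      members (true ∷ s)  = fzero ∷ map fsuc (members s)
      members (false ∷ s) = map fsuc (members s)

  signed : ℕ → Carrier → Carrier
  signed zero    x = x
  signed (suc k) x = - signed k x

  -- A chain of size s (i.e. of dimension s - 1) on Γ: a function on
  -- subsets vanishing outside the faces of Γ with s vertices.
  IsChain : ∀ {n} → (Subset n → Bool) → ℕ → (Subset n → Carrier) → Set ℓ
  IsChain Γ s x = ∀ σ → (Γ σ ∧ (∣ σ ∣ ℕ.≡ᵇ s)) ≡ false → x σ ≈ 0#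

  ∂ : ∀ {n} → (Subset n → Carrier) → (Subset n → Carrier)
  ∂ x τ = sumFin (λ v → if lookup τ v then 0# else signed (below τ v) (x (τ ∪ ⁅ v ⁆)))

  -- Reduced homology in dimension s - 1 vanishes: every (s-1)-cycle
  -- is a boundary of an s-chain.
  HomologyVanishes : ∀ {n} → (Subset n → Bool) → ℕ → Set (c ⊔ ℓ)
  HomologyVanishes Γ s =
    ∀ x → IsChain Γ s x → (∀ τ → ∂ x τ ≈ 0#) →
    ∃ λ y → IsChain Γ (suc s) y × (∀ σ → ∂ y σ ≈ x σ)

  HasFaceLargerThan : ∀ {n} → (Subset n → Bool) → ℕ → Set
  HasFaceLargerThan Γ s = ∃ λ σ → IsFace Γ σ × s < ∣ σ ∣

  -- Cohen–Macaulay over K (Reisner): for every face F of Γ (including ∅),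
  -- H̃_j(lk F; K) = 0 for all j < dim lk F.
  IsCohenMacaulay : ∀ {n} → (Subset n → Bool) → Set (c ⊔ ℓ)
  IsCohenMacaulay Γ =
    ∀ F → IsFace Γ F → ∀ s → HasFaceLargerThan (linkF Γ F) s →
    HomologyVanishes (linkF Γ F) s

allSubsets : (n : ℕ) → List (Subset n)
allSubsets zero    = [] ∷ []
allSubsets (suc n) = map (true ∷_) (allSubsets n) ++ map (false ∷_) (allSubsets n)

f : ∀ {n} → SimplicialComplex n → ℕ → ℕ
f {n} Δ j = length (filter (λ σ → (SimplicialComplex.face Δ σ ∧ (∣ σ ∣ ℕ.≡ᵇ suc j)) ≟ true) (allSubsets n))

sgn : ℕ → ℤ
sgn zero    = + 1
sgn (suc j) = ℤ.- sgn j

χ : ∀ {n} → SimplicialComplex n → ℕ → ℤ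
χ Δ zero    = + f Δ 0
χ Δ (suc i) = χ Δ i ℤ.+ sgn (suc i) ℤ.* + f Δ (suc i)

{-# OPTIONS --safe #-}
module Submission where

-- A face τ with s
-- vertices lies in a facet with d vertices, so at least d − s vertices v ∉ τ make
-- τ ∪ {v} a face; counting such pairs (τ, v) through σ = τ ∪ {v} gives
-- (d − s) f_{s−1} ≤ (s + 1) f_s. Hence f₀ ≤ f₁ ≤ ⋯ ≤ f_i when 2i + 1 ≤ d, and
-- (−1)^i χ_i = f_i − f_{i−1} + ⋯ ± f₀ is then non-negative (and at most f_i).

open import Defs
open import Level using (Level)
open import Data.Nat using (ℕ; _≤_; _+_; _*_)
open import Data.Integer using (+_) renaming (_≤_ to _≤ℤ_; _*_ to _*ℤ_)

open import Data.Bool using (Bool; true; false; _∧_; not; if_then_else_; _≟_; T)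
open import Data.Unit using (tt)
open import Data.Fin using (Fin) renaming (zero to fzero; suc to fsuc)
open import Data.Fin.Subset using (Subset; _∪_; ⁅_⁆; ∣_∣; _⊆_; _∈_; ⊥)
open import Data.Fin.Subset.Properties
  using (⊆-antisym; p⊆p∪q; q⊆p∪q; x∈p∪q⁻; x∈⁅x⁆; x∈⁅y⁆⇒x≡y; ∪-identityʳ)
open import Data.Integer as ℤ using (ℤ)
import Data.Integer.Properties as ℤ
open import Data.Integer.Tactic.RingSolver using (solve-∀)
open import Data.List using (List; []; _∷_; _++_; map; filter; length; allFin)
import Data.List.Properties as List
import Data.List.Membership.Propositional as List
open import Data.List.Membership.Propositional.Properties using (∈-allFin)
open import Data.List.Relation.Unary.Any using (here; there)
open import Data.Nat as ℕ using (zero; suc; z≤n; s≤s; _∸_; _<_)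
open import Data.Nat.ListAction as List using ()
open import Data.Nat.ListAction.Properties using (sum-++)
import Data.Nat.Properties as ℕ
import Data.Nat.Tactic.RingSolver as ℕ-Solver
open import Data.Product using (_×_; _,_; ∃)
open import Data.Sum using (inj₁; inj₂)
open import Data.Vec using (_∷_; []; lookup)
open import Data.Vec.Properties using (lookup⇒[]=)
open import Function using (_∘_)
open import Relation.Binary.PropositionalEquality
open import Algebra.Properties.Semiring.Sum ℕ.+-*-semiring
  using (sum; sum-cong-≗; ∑-distrib-+; *-distribˡ-sum; *-distribʳ-sum)

𝟙 : Bool → ℕ
𝟙 true  = 1
𝟙 false = 0

sum-mono-≤ : ∀ {n} {a b : Fin n → ℕ} → (∀ v → a v ≤ b v) → sum a ≤ sum b
sum-mono-≤ {zero}  a≤b = z≤n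
sum-mono-≤ {suc n} a≤b = ℕ.+-mono-≤ (a≤b fzero) (sum-mono-≤ (a≤b ∘ fsuc))

sum-𝟙≡∣∣ : ∀ {n} (σ : Subset n) → sum (λ v → 𝟙 (lookup σ v)) ≡ ∣ σ ∣
sum-𝟙≡∣∣ []          = refl
sum-𝟙≡∣∣ (true  ∷ σ) = cong suc (sum-𝟙≡∣∣ σ)
sum-𝟙≡∣∣ (false ∷ σ) = sum-𝟙≡∣∣ σ

∑ˢ : ∀ {n} → (Subset n → ℕ) → ℕ
∑ˢ {zero}  φ = φ []
∑ˢ {suc n} φ = ∑ˢ (φ ∘ (true ∷_)) + ∑ˢ (φ ∘ (false ∷_))

∑ˢ-cong : ∀ {n} {φ ψ : Subset n → ℕ} → (∀ σ → φ σ ≡ ψ σ) → ∑ˢ φ ≡ ∑ˢ ψ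
∑ˢ-cong {zero}  φ≗ψ = φ≗ψ []
∑ˢ-cong {suc n} φ≗ψ = cong₂ _+_ (∑ˢ-cong (φ≗ψ ∘ (true ∷_))) (∑ˢ-cong (φ≗ψ ∘ (false ∷_)))

∑ˢ-mono-≤ : ∀ {n} {φ ψ : Subset n → ℕ} → (∀ σ → φ σ ≤ ψ σ) → ∑ˢ φ ≤ ∑ˢ ψ
∑ˢ-mono-≤ {zero}  φ≤ψ = φ≤ψ []
∑ˢ-mono-≤ {suc n} φ≤ψ = ℕ.+-mono-≤ (∑ˢ-mono-≤ (φ≤ψ ∘ (true ∷_))) (∑ˢ-mono-≤ (φ≤ψ ∘ (false ∷_)))

∑ˢ-zero : ∀ n → ∑ˢ {n} (λ _ → 0) ≡ 0
∑ˢ-zero zero    = refl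
∑ˢ-zero (suc n) = cong₂ _+_ (∑ˢ-zero n) (∑ˢ-zero n)

*-distribˡ-∑ˢ : ∀ {n} k (φ : Subset n → ℕ) → k * ∑ˢ φ ≡ ∑ˢ (λ σ → k * φ σ)
*-distribˡ-∑ˢ {zero}  k φ = refl
*-distribˡ-∑ˢ {suc n} k φ = trans (ℕ.*-distribˡ-+ k (∑ˢ (φ ∘ (true ∷_))) (∑ˢ (φ ∘ (false ∷_))))
  (cong₂ _+_ (*-distribˡ-∑ˢ k (φ ∘ (true ∷_))) (*-distribˡ-∑ˢ k (φ ∘ (false ∷_))))

∑ˢ-sum-comm : ∀ {n m} (h : Subset n → Fin m → ℕ) →
  ∑ˢ (λ σ → sum (h σ)) ≡ sum (λ v → ∑ˢ (λ σ → h σ v))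
∑ˢ-sum-comm {zero}  h = refl
∑ˢ-sum-comm {suc n} h = trans
  (cong₂ _+_ (∑ˢ-sum-comm (h ∘ (true ∷_))) (∑ˢ-sum-comm (h ∘ (false ∷_))))
  (sym (∑-distrib-+ (λ v → ∑ˢ (λ σ → h (true ∷ σ) v)) (λ v → ∑ˢ (λ σ → h (false ∷ σ) v))))

∑ˢ-insert : ∀ {n} (v : Fin n) (φ : Subset n → ℕ) →
  ∑ˢ (λ τ → 𝟙 (not (lookup τ v)) * φ (τ ∪ ⁅ v ⁆)) ≡ ∑ˢ (λ σ → 𝟙 (lookup σ v) * φ σ)
∑ˢ-insert {suc n} fzero φ = begin
  ∑ˢ {n} (λ _ → 0) + ∑ˢ (λ τ → φ (true ∷ (τ ∪ ⊥)) + 0)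
    ≡⟨ cong₂ _+_ (∑ˢ-zero n) (∑ˢ-cong (λ τ → cong (λ σ → φ (true ∷ σ) + 0) (∪-identityʳ τ))) ⟩
  0 + ∑ˢ (λ σ → φ (true ∷ σ) + 0)
    ≡⟨ ℕ.+-comm 0 _ ⟩
  ∑ˢ (λ σ → φ (true ∷ σ) + 0) + 0
    ≡⟨ cong₂ _+_ refl (sym (∑ˢ-zero n)) ⟩
  ∑ˢ (λ σ → φ (true ∷ σ) + 0) + ∑ˢ {n} (λ _ → 0) ∎
  where open ≡-Reasoning
∑ˢ-insert {suc n} (fsuc v) φ =
  cong₂ _+_ (∑ˢ-insert v (φ ∘ (true ∷_))) (∑ˢ-insert v (φ ∘ (false ∷_)))

-- Counting pairs (τ, v) with v ∉ τ by σ = τ ∪ {v} instead: each σ arises ∣ σ ∣ times.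
∑ˢ-∑-insert≡∑ˢ-∣∣ : ∀ {n} (φ : Subset n → ℕ) →
  ∑ˢ (λ τ → sum (λ v → 𝟙 (not (lookup τ v)) * φ (τ ∪ ⁅ v ⁆))) ≡ ∑ˢ (λ σ → ∣ σ ∣ * φ σ)
∑ˢ-∑-insert≡∑ˢ-∣∣ φ = begin
  ∑ˢ (λ τ → sum (λ v → 𝟙 (not (lookup τ v)) * φ (τ ∪ ⁅ v ⁆)))
    ≡⟨ ∑ˢ-sum-comm (λ τ v → 𝟙 (not (lookup τ v)) * φ (τ ∪ ⁅ v ⁆)) ⟩
  sum (λ v → ∑ˢ (λ τ → 𝟙 (not (lookup τ v)) * φ (τ ∪ ⁅ v ⁆)))
    ≡⟨ sum-cong-≗ (λ v → ∑ˢ-insert v φ) ⟩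
  sum (λ v → ∑ˢ (λ σ → 𝟙 (lookup σ v) * φ σ))
    ≡⟨ sym (∑ˢ-sum-comm (λ σ v → 𝟙 (lookup σ v) * φ σ)) ⟩
  ∑ˢ (λ σ → sum (λ v → 𝟙 (lookup σ v) * φ σ))
    ≡⟨ ∑ˢ-cong (λ σ → trans (sym (*-distribʳ-sum (φ σ) (𝟙 ∘ lookup σ))) (cong (_* φ σ) (sum-𝟙≡∣∣ σ))) ⟩
  ∑ˢ (λ σ → ∣ σ ∣ * φ σ) ∎
  where open ≡-Reasoning

length-filter≡sum-𝟙 : ∀ {A : Set} (b : A → Bool) (xs : List A) →
  length (filter (λ x → b x ≟ true) xs) ≡ List.sum (map (𝟙 ∘ b) xs)
length-filter≡sum-𝟙 b []       = refl
length-filter≡sum-𝟙 b (x ∷ xs) with b x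
... | true  = cong suc (length-filter≡sum-𝟙 b xs)
... | false = length-filter≡sum-𝟙 b xs

∑ˢ≡sum-allSubsets : ∀ n (φ : Subset n → ℕ) → ∑ˢ φ ≡ List.sum (map φ (allSubsets n))
∑ˢ≡sum-allSubsets zero    φ = sym (ℕ.+-identityʳ (φ []))
∑ˢ≡sum-allSubsets (suc n) φ = begin
  ∑ˢ (φ ∘ (true ∷_)) + ∑ˢ (φ ∘ (false ∷_))
    ≡⟨ cong₂ _+_ (∑ˢ≡sum-allSubsets n _) (∑ˢ≡sum-allSubsets n _) ⟩
  List.sum (map (φ ∘ (true ∷_)) A) + List.sum (map (φ ∘ (false ∷_)) A)
    ≡⟨ cong₂ _+_ (cong List.sum (List.map-∘ A)) (cong List.sum (List.map-∘ A)) ⟩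
  List.sum (map φ (map (true ∷_) A)) + List.sum (map φ (map (false ∷_) A))
    ≡⟨ sym (sum-++ (map φ (map (true ∷_) A)) _) ⟩
  List.sum (map φ (map (true ∷_) A) ++ map φ (map (false ∷_) A))
    ≡⟨ cong List.sum (sym (List.map-++ φ (map (true ∷_) A) _)) ⟩
  List.sum (map φ (allSubsets (suc n))) ∎
  where
  open ≡-Reasoning
  A = allSubsets n

≡ᵇ≡true⇒≡ : ∀ {m n} → (m ℕ.≡ᵇ n) ≡ true → m ≡ n
≡ᵇ≡true⇒≡ {m} {n} eq = ℕ.≡ᵇ⇒≡ m n (subst T (sym eq) tt)

∪-lub : ∀ {n} {p q r : Subset n} → p ⊆ r → q ⊆ r → p ∪ q ⊆ r
∪-lub {p = p} {q} p⊆r q⊆r x∈p∪q with x∈p∪q⁻ p q x∈p∪q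
... | inj₁ x∈p = p⊆r x∈p
... | inj₂ x∈q = q⊆r x∈q

∪-monoˡ-⊆ : ∀ {n} {p q : Subset n} r → p ⊆ q → p ∪ r ⊆ q ∪ r
∪-monoˡ-⊆ {q = q} r p⊆q = ∪-lub (p⊆p∪q r ∘ p⊆q) (q⊆p∪q q r)

⁅x⁆⊆p : ∀ {n} {x : Fin n} {p} → x ∈ p → ⁅ x ⁆ ⊆ p
⁅x⁆⊆p {x = x} {p} x∈p y∈⁅x⁆ = subst (_∈ p) (sym (x∈⁅y⁆⇒x≡y x y∈⁅x⁆)) x∈p

∣p∪⁅x⁆∣≡1+∣p∣ : ∀ {n} (p : Subset n) (x : Fin n) → lookup p x ≡ false → ∣ p ∪ ⁅ x ⁆ ∣ ≡ suc ∣ p ∣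
∣p∪⁅x⁆∣≡1+∣p∣ (false ∷ p) fzero    _ = cong (suc ∘ ∣_∣) (∪-identityʳ p)
∣p∪⁅x⁆∣≡1+∣p∣ (true  ∷ p) (fsuc x) x∉p = cong suc (∣p∪⁅x⁆∣≡1+∣p∣ p x x∉p)
∣p∪⁅x⁆∣≡1+∣p∣ (false ∷ p) (fsuc x) x∉p = ∣p∪⁅x⁆∣≡1+∣p∣ p x x∉p

module _ {n} (Δ : SimplicialComplex n) where
  open SimplicialComplex Δ

  isFaceOfSize : ℕ → Subset n → Bool
  isFaceOfSize s σ = face σ ∧ (∣ σ ∣ ℕ.≡ᵇ s)

  faces : ℕ → ℕ
  faces s = ∑ˢ (𝟙 ∘ isFaceOfSize s)

  f≡faces : ∀ j → f Δ j ≡ faces (suc j)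
  f≡faces j = trans (length-filter≡sum-𝟙 (isFaceOfSize (suc j)) (allSubsets n))
                    (sym (∑ˢ≡sum-allSubsets n _))

  extends : Subset n → Fin n → Bool
  extends τ v = not (lookup τ v) ∧ face (τ ∪ ⁅ v ⁆)

  upDegree : Subset n → ℕ
  upDegree τ = sum (𝟙 ∘ extends τ)

  ∑ˢ-upDegree : ∀ s → ∑ˢ (λ τ → 𝟙 (isFaceOfSize s τ) * upDegree τ) ≡ suc s * faces (suc s)
  ∑ˢ-upDegree s = begin
    ∑ˢ (λ τ → 𝟙 (isFaceOfSize s τ) * upDegree τ)
      ≡⟨ ∑ˢ-cong (λ τ → *-distribˡ-sum (𝟙 (isFaceOfSize s τ)) (𝟙 ∘ extends τ)) ⟩
    ∑ˢ (λ τ → sum (λ v → 𝟙 (isFaceOfSize s τ) * 𝟙 (extends τ v)))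
      ≡⟨ ∑ˢ-cong (λ τ → sum-cong-≗ (coface τ)) ⟩
    ∑ˢ (λ τ → sum (λ v → 𝟙 (not (lookup τ v)) * φ (τ ∪ ⁅ v ⁆)))
      ≡⟨ ∑ˢ-∑-insert≡∑ˢ-∣∣ φ ⟩
    ∑ˢ (λ σ → ∣ σ ∣ * φ σ)
      ≡⟨ ∑ˢ-cong size ⟩
    ∑ˢ (λ σ → suc s * φ σ)
      ≡⟨ sym (*-distribˡ-∑ˢ (suc s) φ) ⟩
    suc s * faces (suc s) ∎
    where
    open ≡-Reasoning
    φ : Subset n → ℕ
    φ = 𝟙 ∘ isFaceOfSize (suc s)

    coface : ∀ τ v → 𝟙 (isFaceOfSize s τ) * 𝟙 (extends τ v)
                   ≡ 𝟙 (not (lookup τ v)) * φ (τ ∪ ⁅ v ⁆)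
    coface τ v with lookup τ v in v∉τ
    ... | true = ℕ.*-zeroʳ (𝟙 (isFaceOfSize s τ))
    ... | false with face (τ ∪ ⁅ v ⁆) in τ∪v∈Δ
    ...   | false = ℕ.*-zeroʳ (𝟙 (isFaceOfSize s τ))
    ...   | true rewrite ∣p∪⁅x⁆∣≡1+∣p∣ τ v v∉τ | down τ∪v∈Δ (p⊆p∪q {p = τ} ⁅ v ⁆) =
            ℕ.*-comm (𝟙 (∣ τ ∣ ℕ.≡ᵇ s)) 1

    size : ∀ σ → ∣ σ ∣ * φ σ ≡ suc s * φ σ
    size σ with face σ | ∣ σ ∣ ℕ.≡ᵇ suc s in eq
    ... | true  | true  = cong (_* 1) (≡ᵇ≡true⇒≡ {∣ σ ∣} eq)
    ... | true  | false = trans (ℕ.*-zeroʳ ∣ σ ∣) (sym (ℕ.*-zeroʳ (suc s)))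
    ... | false | _     = trans (ℕ.*-zeroʳ ∣ σ ∣) (sym (ℕ.*-zeroʳ (suc s)))

  upDegree-≥⇒faces-≤ : ∀ s k → (∀ τ → IsFace face τ → ∣ τ ∣ ≡ s → k ≤ upDegree τ) →
    k * faces s ≤ suc s * faces (suc s)
  upDegree-≥⇒faces-≤ s k k≤upDegree = begin
    k * faces s                                   ≡⟨ *-distribˡ-∑ˢ k (𝟙 ∘ isFaceOfSize s) ⟩
    ∑ˢ (λ τ → k * 𝟙 (isFaceOfSize s τ))           ≤⟨ ∑ˢ-mono-≤ weighted ⟩
    ∑ˢ (λ τ → 𝟙 (isFaceOfSize s τ) * upDegree τ)  ≡⟨ ∑ˢ-upDegree s ⟩
    suc s * faces (suc s)                         ∎
    where
    open ℕ.≤-Reasoning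
    weighted : ∀ τ → k * 𝟙 (isFaceOfSize s τ) ≤ 𝟙 (isFaceOfSize s τ) * upDegree τ
    weighted τ with face τ in τ∈Δ | ∣ τ ∣ ℕ.≡ᵇ s in eq
    ... | true  | true  = subst₂ _≤_ (sym (ℕ.*-identityʳ k)) (sym (ℕ.*-identityˡ (upDegree τ)))
                                   (k≤upDegree τ τ∈Δ (≡ᵇ≡true⇒≡ eq))
    ... | true  | false = ℕ.≤-reflexive (ℕ.*-zeroʳ k)
    ... | false | _     = ℕ.≤-reflexive (ℕ.*-zeroʳ k)

  ∣σ∣≤∣τ∣+upDegree : ∀ {σ τ} → IsFace face σ → τ ⊆ σ → ∣ σ ∣ ≤ ∣ τ ∣ + upDegree τ
  ∣σ∣≤∣τ∣+upDegree {σ} {τ} σ∈Δ τ⊆σ = begin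
    ∣ σ ∣                             ≡⟨ sum-𝟙≡∣∣ σ ⟨
    sum (λ v → 𝟙 (lookup σ v))        ≤⟨ sum-mono-≤ vertexwise ⟩
    sum (λ v → 𝟙 (lookup τ v) + 𝟙 (extends τ v))
                                      ≡⟨ ∑-distrib-+ (𝟙 ∘ lookup τ) _ ⟩
    sum (𝟙 ∘ lookup τ) + upDegree τ   ≡⟨ cong (_+ upDegree τ) (sum-𝟙≡∣∣ τ) ⟩
    ∣ τ ∣ + upDegree τ                ∎
    where
    open ℕ.≤-Reasoning
    vertexwise : ∀ v → 𝟙 (lookup σ v) ≤ 𝟙 (lookup τ v) + 𝟙 (extends τ v)
    vertexwise v with lookup σ v in v∈σ | lookup τ v
    ... | false | _     = z≤n
    ... | true  | true  = s≤s z≤n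
    ... | true  | false rewrite down σ∈Δ (∪-lub τ⊆σ (⁅x⁆⊆p (lookup⇒[]= v σ v∈σ))) = s≤s z≤n

  saturate : Subset n → List (Fin n) → Subset n
  saturate σ []       = σ
  saturate σ (v ∷ vs) = if face (σ ∪ ⁅ v ⁆) then saturate (σ ∪ ⁅ v ⁆) vs else saturate σ vs

  saturate-face : ∀ σ vs → IsFace face σ → IsFace face (saturate σ vs)
  saturate-face σ []       σ∈Δ = σ∈Δ
  saturate-face σ (v ∷ vs) σ∈Δ with face (σ ∪ ⁅ v ⁆) in σ∪v∈Δ
  ... | true  = saturate-face (σ ∪ ⁅ v ⁆) vs σ∪v∈Δ
  ... | false = saturate-face σ vs σ∈Δ

  ⊆-saturate : ∀ σ vs → σ ⊆ saturate σ vs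
  ⊆-saturate σ []       x∈σ = x∈σ
  ⊆-saturate σ (v ∷ vs) x∈σ with face (σ ∪ ⁅ v ⁆)
  ... | true  = ⊆-saturate (σ ∪ ⁅ v ⁆) vs (p⊆p∪q ⁅ v ⁆ x∈σ)
  ... | false = ⊆-saturate σ vs x∈σ

  saturate-saturated : ∀ σ vs {v} → v List.∈ vs → IsFace face (saturate σ vs ∪ ⁅ v ⁆) →
    v ∈ saturate σ vs
  saturate-saturated σ (v ∷ vs) (here refl) sat∪v∈Δ with face (σ ∪ ⁅ v ⁆) in σ∪v∈Δ
  ... | true  = ⊆-saturate (σ ∪ ⁅ v ⁆) vs (q⊆p∪q σ ⁅ v ⁆ (x∈⁅x⁆ v))
  ... | false with () ← trans (sym σ∪v∈Δ) (down sat∪v∈Δ (∪-monoˡ-⊆ ⁅ v ⁆ (⊆-saturate σ vs)))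
  saturate-saturated σ (w ∷ vs) (there v∈vs) sat∪v∈Δ with face (σ ∪ ⁅ w ⁆)
  ... | true  = saturate-saturated (σ ∪ ⁅ w ⁆) vs v∈vs sat∪v∈Δ
  ... | false = saturate-saturated σ vs v∈vs sat∪v∈Δ

  ⊆-facet : ∀ {d} → IsPureOfDim-1+ Δ d → ∀ {τ} → IsFace face τ →
    ∃ λ σ → IsFace face σ × τ ⊆ σ × ∣ σ ∣ ≡ d
  ⊆-facet pure {τ} τ∈Δ = σ , σ∈Δ , ⊆-saturate τ (allFin n) , pure σ (σ∈Δ , maximal)
    where
    σ : Subset n
    σ = saturate τ (allFin n)
    σ∈Δ : IsFace face σ
    σ∈Δ = saturate-face τ (allFin n) τ∈Δ
    maximal : ∀ ρ → IsFace face ρ → σ ⊆ ρ → ρ ≡ σ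
    maximal ρ ρ∈Δ σ⊆ρ = ⊆-antisym
      (λ {v} v∈ρ → saturate-saturated τ (allFin n) (∈-allFin v) (down ρ∈Δ (∪-lub σ⊆ρ (⁅x⁆⊆p v∈ρ))))
      σ⊆ρ

  pure⇒d∸∣τ∣≤upDegree : ∀ {d} → IsPureOfDim-1+ Δ d → ∀ {τ} → IsFace face τ → d ∸ ∣ τ ∣ ≤ upDegree τ
  pure⇒d∸∣τ∣≤upDegree {d} pure {τ} τ∈Δ =
    let σ , σ∈Δ , τ⊆σ , ∣σ∣≡d = ⊆-facet pure τ∈Δ
    in ℕ.m≤n+o⇒m∸n≤o d ∣ τ ∣ (subst (_≤ ∣ τ ∣ + upDegree τ) ∣σ∣≡d (∣σ∣≤∣τ∣+upDegree σ∈Δ τ⊆σ))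

  pure⇒faces-mono : ∀ {d} → IsPureOfDim-1+ Δ d → ∀ s → 2 * s + 1 ≤ d → faces s ≤ faces (suc s)
  pure⇒faces-mono {d} pure s 2s+1≤d = ℕ.*-cancelˡ-≤ (suc s) (begin
    suc s * faces s        ≤⟨ ℕ.*-monoˡ-≤ (faces s) 1+s≤d∸s ⟩
    (d ∸ s) * faces s      ≤⟨ upDegree-≥⇒faces-≤ s (d ∸ s) d∸s≤upDegree ⟩
    suc s * faces (suc s)  ∎)
    where
    open ℕ.≤-Reasoning
    2*s+1≡1+s+s : ∀ s → 2 * s + 1 ≡ suc s + s
    2*s+1≡1+s+s = ℕ-Solver.solve-∀
    1+s≤d∸s : suc s ≤ d ∸ s
    1+s≤d∸s = ℕ.m+n≤o⇒m≤o∸n (suc s) (subst (_≤ d) (2*s+1≡1+s+s s) 2s+1≤d)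
    d∸s≤upDegree : ∀ τ → IsFace face τ → ∣ τ ∣ ≡ s → d ∸ s ≤ upDegree τ
    d∸s≤upDegree τ τ∈Δ refl = pure⇒d∸∣τ∣≤upDegree pure τ∈Δ

alternatingSum : (ℕ → ℕ) → ℕ → ℤ
alternatingSum a zero    = + a 0
alternatingSum a (suc i) = alternatingSum a i ℤ.+ sgn (suc i) *ℤ + a (suc i)

χ≡alternatingSum-f : ∀ {n} (Δ : SimplicialComplex n) i → χ Δ i ≡ alternatingSum (f Δ) i
χ≡alternatingSum-f Δ zero    = refl
χ≡alternatingSum-f Δ (suc i) = cong (ℤ._+ sgn (suc i) *ℤ + f Δ (suc i)) (χ≡alternatingSum-f Δ i)

sgn*sgn≡1 : ∀ i → sgn i *ℤ sgn i ≡ + 1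
sgn*sgn≡1 zero    = refl
sgn*sgn≡1 (suc i) = trans (-x*-x≡x*x (sgn i)) (sgn*sgn≡1 i)
  where
  -x*-x≡x*x : ∀ x → ℤ.- x *ℤ ℤ.- x ≡ x *ℤ x
  -x*-x≡x*x = solve-∀

sgn[1+i]*[x+sgn[1+i]*y]≡y-sgn[i]*x : ∀ i x y →
  sgn (suc i) *ℤ (x ℤ.+ sgn (suc i) *ℤ y) ≡ y ℤ.- sgn i *ℤ x
sgn[1+i]*[x+sgn[1+i]*y]≡y-sgn[i]*x i x y = begin
  ℤ.- s *ℤ (x ℤ.+ ℤ.- s *ℤ y)    ≡⟨ expand s x y ⟩
  (s *ℤ s) *ℤ y ℤ.- s *ℤ x        ≡⟨ cong (λ t → t *ℤ y ℤ.- s *ℤ x) (sgn*sgn≡1 i) ⟩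
  + 1 *ℤ y ℤ.- s *ℤ x             ≡⟨ cong (ℤ._- s *ℤ x) (ℤ.*-identityˡ y) ⟩
  y ℤ.- s *ℤ x                    ∎
  where
  open ≡-Reasoning
  s : ℤ
  s = sgn i
  expand : ∀ s x y → ℤ.- s *ℤ (x ℤ.+ ℤ.- s *ℤ y) ≡ (s *ℤ s) *ℤ y ℤ.- s *ℤ x
  expand = solve-∀

-- The upper bound b ≤ a i is what keeps the induction going.
sgn*alternatingSum≡+ : ∀ (a : ℕ → ℕ) i → (∀ {j} → j < i → a j ≤ a (suc j)) →
  ∃ λ b → sgn i *ℤ alternatingSum a i ≡ + b × b ≤ a i
sgn*alternatingSum≡+ a zero    _    = a 0 , ℤ.*-identityˡ (+ a 0) , ℕ.≤-refl
sgn*alternatingSum≡+ a (suc i) mono =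
  let b , sgn*Σ≡b , b≤aᵢ = sgn*alternatingSum≡+ a i (mono ∘ ℕ.m<n⇒m<1+n)
      b≤aᵢ₊₁ = ℕ.≤-trans b≤aᵢ (mono (ℕ.n<1+n i))
  in a (suc i) ∸ b , (begin
       sgn (suc i) *ℤ alternatingSum a (suc i)
         ≡⟨ sgn[1+i]*[x+sgn[1+i]*y]≡y-sgn[i]*x i (alternatingSum a i) (+ a (suc i)) ⟩
       + a (suc i) ℤ.- sgn i *ℤ alternatingSum a i ≡⟨ cong (λ t → + a (suc i) ℤ.- t) sgn*Σ≡b ⟩
       + a (suc i) ℤ.- + b                         ≡⟨ ℤ.m-n≡m⊖n (a (suc i)) b ⟩
       a (suc i) ℤ.⊖ b                             ≡⟨ ℤ.⊖-≥ b≤aᵢ₊₁ ⟩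
       + (a (suc i) ∸ b)                           ∎)
     , ℕ.m∸n≤m (a (suc i)) b
  where open ≡-Reasoning

0≤sgn*alternatingSum : ∀ (a : ℕ → ℕ) i → (∀ {j} → j < i → a j ≤ a (suc j)) →
  + 0 ≤ℤ sgn i *ℤ alternatingSum a i
0≤sgn*alternatingSum a i mono =
  let b , sgn*Σ≡b , _ = sgn*alternatingSum≡+ a i mono
  in subst (+ 0 ≤ℤ_) (sym sgn*Σ≡b) (ℤ.+≤+ z≤n)

proposition4p1 : ∀ {c ℓ : Level} (K : Field c ℓ) {n : ℕ} (Δ : SimplicialComplex n) (d : ℕ) →
    IsPureOfDim-1+ Δ d →
    (∀ v → IsVertex Δ v → Homology.IsCohenMacaulay K (vertexLink Δ v)) →
    ∀ (i : ℕ) → 2 * i + 1 ≤ d →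
    + 0 ≤ℤ sgn i *ℤ χ Δ i
proposition4p1 K Δ d pure _ i 2i+1≤d =
  subst (λ x → + 0 ≤ℤ sgn i *ℤ x) (sym (χ≡alternatingSum-f Δ i)) (0≤sgn*alternatingSum (f Δ) i f-mono)
  where
  f-mono : ∀ {j} → j < i → f Δ j ≤ f Δ (suc j)
  f-mono {j} j<i = subst₂ _≤_ (sym (f≡faces Δ j)) (sym (f≡faces Δ (suc j)))
    (pure⇒faces-mono Δ pure (suc j) (ℕ.≤-trans (ℕ.+-monoˡ-≤ 1 (ℕ.*-monoʳ-≤ 2 j<i)) 2i+1≤d))
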